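{- Let $q\ge 3$ be an odd integer, and let $H$ be a graph of odd girth $q$ that does not contain $C_4$ as a subgraph. Then for every integer $p\ge 1$ the graph $G_{q,p}$ is a minimal obstruction to $H$-coloring.
   Context: All graphs are finite and simple. For graphs $G$ and $H$, an $H$-coloring of $G$ is a map $c: V(G)\to V(H)$ such that $c(u)c(v)\in E(H)$ for every edge $uv\in E(G)$. A graph $G$ is a minimal obstruction to $H$-coloring if $G$ has no $H$-coloring but every proper induced subgraph of $G$ has an $H$-coloring. The odd girth of a graph is the length of a shortest odd cycle in it; "subgraph" means not necessarily induced. For odd $q\ge 3$ and $p\ge 1$, $G_{q,p}$ is the graph with vertex set $\{0,1,\dots,qp-3\}$, where arithmetic on vertices is modulo $qp-2$, in which the neighborhood of each vertex $i$ is $N(i)=\{i-1,i+1\}\cup\{i+qj-1 : j\in\{1,\dots,p-1\}\}$. -}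

module Defs where

open import Data.Nat using (ℕ; zero; suc; _+_; _*_; _∸_; _≤_)
open import Data.Nat.DivMod using (_%_; m%n<n)
open import Data.Fin using (Fin; toℕ; fromℕ<)
open import Data.Bool using (Bool; true; false; _∨_)
open import Data.Nat using (_≡ᵇ_)
open import Data.Product using (Σ; ∃; _×_)
open import Relation.Binary.PropositionalEquality using (_≡_)
open import Function.Definitions using (Injective)
open import Relation.Nullary using (¬_)

record Graph : Set where
  field
    size  : ℕ
    adj   : Fin size → Fin size → Bool
    sym   : ∀ u v → adj u v ≡ adj v u
    irrefl : ∀ v → adj v v ≡ false
open Graph public

Adj : ℕ → Set
Adj n = Fin n → Fin n → Bool

ColoringOn : (H : Graph) {n : ℕ} → Adj n → (Fin n → Bool) → Set
ColoringOn H {n} E S =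
  Σ ((v : Fin n) → S v ≡ true → Fin (size H)) λ c →
    ∀ u v (su : S u ≡ true) (sv : S v ≡ true) →
      E u v ≡ true → adj H (c u su) (c v sv) ≡ true

Coloring : (H : Graph) {n : ℕ} → Adj n → Set
Coloring H {n} E =
  Σ (Fin n → Fin (size H)) λ c → ∀ u v → E u v ≡ true → adj H (c u) (c v) ≡ true

-- Minimal obstruction: no H-coloring, but every proper induced subgraph
-- (vertex subset S missing at least one vertex) has an H-coloring.
MinimalObstruction : (H : Graph) {n : ℕ} → Adj n → Set
MinimalObstruction H {n} E =
  (¬ Coloring H E) ×
  (∀ (S : Fin n → Bool) → (∃ λ v → S v ≡ false) → ColoringOn H E S)

nextMod : {k : ℕ} → Fin k → Fin k
nextMod {suc k} i = fromℕ< (m%n<n (suc (toℕ i)) (suc k))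

Cycle : Graph → ℕ → Set
Cycle H k = (3 ≤ k) ×
  Σ (Fin k → Fin (size H)) λ f →
    Injective _≡_ _≡_ f × (∀ i → adj H (f i) (f (nextMod i)) ≡ true)

Odd : ℕ → Set
Odd k = ∃ λ t → k ≡ suc (2 * t)

-- H has odd girth q: H has a cycle of length q, and every odd cycle of H
-- has length at least q (q is assumed odd separately).
OddGirth : Graph → ℕ → Set
OddGirth H q = Cycle H q × (∀ k → Odd k → Cycle H k → q ≤ k)

ContainsC4 : Graph → Set
ContainsC4 H = Cycle H 4

-- x mod n (only used with n ≥ 1)
modℕ : ℕ → ℕ → ℕ
modℕ zero x = x
modℕ (suc n) x = x % suc n

gsize : ℕ → ℕ → ℕ
gsize q p = q * p ∸ 2

-- is there t ∈ {1, …, p-1} with j ≡ i + q t - 1 (mod n)?  (checks t = p-1, …, 1)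
longJump : (n q i j : ℕ) → ℕ → Bool
longJump n q i j zero = false
longJump n q i j (suc zero) = false
longJump n q i j (suc (suc t)) =
  (j ≡ᵇ modℕ n (i + q * suc t ∸ 1)) ∨ longJump n q i j (suc t)

-- G_{q,p}: vertices 0..qp-3, arithmetic mod qp-2,
-- N(i) = {i-1, i+1} ∪ {i + q t - 1 : 1 ≤ t ≤ p-1}.
Gqp : (q p : ℕ) → Adj (gsize q p)
Gqp q p u v =
  let n = gsize q p ; i = toℕ u ; j = toℕ v in
  (j ≡ᵇ modℕ n (suc i)) ∨ (i ≡ᵇ modℕ n (suc j)) ∨ longJump n q i j p

{-# OPTIONS --safe #-}
-- Read along the Hamiltonian cycle 0, 1, …, n - 1 of G_{q,p} (n = qp - 2), an H-coloring is an
-- n-periodic walk w in H. For p = 1 one period is a closed walk of odd length q - 2, which is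
-- impossible since an odd closed walk contains an odd cycle no longer than itself. For p ≥ 2 every
-- chord i ~ i + q - 1 turns w i, w (i + 1), w (i + q), w (i + q - 1) into a closed 4-walk; as H has
-- no C₄ one diagonal collapses, and w (i + 1) = w (i + q - 1) would again close a walk of odd
-- length q - 2, so w is q-periodic. Together with n + 2 = qp this makes w 2-periodic, hence
-- 1-periodic as q is odd, contradicting w 0 ~ w 1.
--
-- Conversely, G_{q,p} - v maps onto a q-cycle of H: number the vertices cyclically starting after v
-- and send the i-th one to the (i mod q)-th vertex of the cycle. Cycle edges of G_{q,p} then raise
-- the index by one and every chord changes it by ±1 modulo q.
module Submission where

open import Defs hiding (sym)
open import Data.Bool using (Bool; true; false; _∨_)
open import Data.Bool.Properties using (T-≡)
open import Data.Empty using (⊥; ⊥-elim)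
open import Data.Fin using (Fin; toℕ)
open import Data.Fin.Properties using (toℕ-fromℕ<; toℕ-injective; toℕ<n)
import Data.Fin as Fin
import Data.Fin.Properties as Finₚ
open import Data.Nat
open import Data.Nat.DivMod
open import Data.Nat.Induction using (<-wellFounded)
open import Data.Nat.Properties
open import Algebra.Properties.CommutativeSemigroup +-commutativeSemigroup using (x∙yz≈y∙xz)
open import Data.Parity.Base using (0ℙ; 1ℙ)
import Data.Parity.Base as ℙ
open import Data.Parity.Properties using (+-homo-+)
open import Data.Product using (Σ; ∃; ∃₂; _×_; _,_)
open import Data.Sum using (_⊎_; inj₁; inj₂; [_,_])
open import Data.Vec using ([]; _∷_; lookup)
open import Data.Vec.Relation.Unary.All using ([]; _∷_)
open import Data.Vec.Relation.Unary.AllPairs using ([]; _∷_)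
open import Data.Vec.Relation.Unary.Unique.Propositional using (Unique)
open import Data.Vec.Relation.Unary.Unique.Propositional.Properties using (lookup-injective)
open import Function using (_∘_; Equivalence)
open import Function.Definitions using (Injective)
open import Induction.WellFounded using (Acc; acc)
open import Relation.Binary.Definitions using (DecidableEquality)
open import Relation.Binary.PropositionalEquality
  using (_≡_; _≢_; refl; sym; trans; cong; subst; module ≡-Reasoning)
open import Relation.Nullary using (¬_; yes; no)

∨-trueˡ : ∀ {a} b → a ≡ true → a ∨ b ≡ true
∨-trueˡ _ refl = refl

∨-trueʳ : ∀ a {b} → b ≡ true → a ∨ b ≡ true
∨-trueʳ true  _  = refl
∨-trueʳ false eq = eq

∨-true⁻ : ∀ a {b} → a ∨ b ≡ true → a ≡ true ⊎ b ≡ true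
∨-true⁻ true  _  = inj₁ refl
∨-true⁻ false eq = inj₂ eq

≡⇒≡ᵇ-true : ∀ {m n} → m ≡ n → (m ≡ᵇ n) ≡ true
≡⇒≡ᵇ-true {m} {n} eq = Equivalence.to T-≡ (≡⇒≡ᵇ m n eq)

≡ᵇ-true⇒≡ : ∀ {m n} → (m ≡ᵇ n) ≡ true → m ≡ n
≡ᵇ-true⇒≡ {m} {n} eq = ≡ᵇ⇒≡ m n (Equivalence.from T-≡ eq)

Odd⇒parity≡1ℙ : ∀ {n} → Odd n → parity n ≡ 1ℙ
Odd⇒parity≡1ℙ (zero  , refl) = refl
Odd⇒parity≡1ℙ (suc t , refl) = trans (cong parity (+-suc t (t + 0))) (Odd⇒parity≡1ℙ (t , refl))

parity≡1ℙ⇒Odd : ∀ n → parity n ≡ 1ℙ → Odd n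
parity≡1ℙ⇒Odd (suc zero)    _  = 0 , refl
parity≡1ℙ⇒Odd (suc (suc n)) eq with parity≡1ℙ⇒Odd n eq
... | t , refl = suc t , cong (suc ∘ suc) (sym (+-suc t (t + 0)))

Odd-+ : ∀ m n → Odd (m + n) → Odd m ⊎ Odd n
Odd-+ m n odd with parity m in pm
... | 1ℙ = inj₁ (parity≡1ℙ⇒Odd m pm)
... | 0ℙ = inj₂ (parity≡1ℙ⇒Odd n (begin
  parity n                   ≡⟨ cong (ℙ._+ parity n) pm ⟨
  parity m ℙ.+ parity n      ≡⟨ +-homo-+ m n ⟨
  parity (m + n)             ≡⟨ Odd⇒parity≡1ℙ odd ⟩
  1ℙ                         ∎))
  where open ≡-Reasoning

<⇒≡+suc : ∀ {m n} → m < n → ∃ λ o → n ≡ m + suc o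
<⇒≡+suc {m} m<n with o , eq ← m≤n⇒∃[o]m+o≡n m<n = o , trans (sym eq) (sym (+-suc m o))

[m%n+o]%n≡[m+o]%n : ∀ m o n .{{_ : NonZero n}} → (m % n + o) % n ≡ (m + o) % n
[m%n+o]%n≡[m+o]%n m o n = begin
  (m % n + o) % n          ≡⟨ %-distribˡ-+ (m % n) o n ⟩
  (m % n % n + o % n) % n  ≡⟨ cong (λ x → (x + o % n) % n) (m%n%n≡m%n m n) ⟩
  (m % n + o % n) % n      ≡⟨ %-distribˡ-+ m o n ⟨
  (m + o) % n              ∎
  where open ≡-Reasoning

[m+o%n]%n≡[m+o]%n : ∀ m o n .{{_ : NonZero n}} → (m + o % n) % n ≡ (m + o) % n
[m+o%n]%n≡[m+o]%n m o n = begin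
  (m + o % n) % n  ≡⟨ cong (_% n) (+-comm m (o % n)) ⟩
  (o % n + m) % n  ≡⟨ [m%n+o]%n≡[m+o]%n o m n ⟩
  (o + m) % n      ≡⟨ cong (_% n) (+-comm o m) ⟩
  (m + o) % n      ∎
  where open ≡-Reasoning

m<n+n⇒m%n≡m⊎m%n+n≡m : ∀ {m n} .{{_ : NonZero n}} → m < n + n → m % n ≡ m ⊎ m % n + n ≡ m
m<n+n⇒m%n≡m⊎m%n+n≡m {m} {n} m<n+n with m <? n
... | yes m<n = inj₁ (m<n⇒m%n≡m m<n)
... | no  m≮n = inj₂ (begin
  m % n + n        ≡⟨ cong (_+ n) (m≤n⇒[n∸m]%m≡n%m n≤m) ⟨
  (m ∸ n) % n + n  ≡⟨ cong (_+ n) (m<n⇒m%n≡m m∸n<n) ⟩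
  m ∸ n + n        ≡⟨ m∸n+n≡m n≤m ⟩
  m                ∎)
  where
  open ≡-Reasoning
  n≤m = ≮⇒≥ m≮n
  m∸n<n : m ∸ n < n
  m∸n<n = subst (m ∸ n <_) (m+n∸m≡n n n) (∸-monoˡ-< m<n+n n≤m)

toℕ-mod : ∀ m n .{{_ : NonZero n}} → toℕ (m mod n) ≡ m % n
toℕ-mod m n = toℕ-fromℕ< _

mod-cong : ∀ {m o} n .{{_ : NonZero n}} → m % n ≡ o % n → m mod n ≡ o mod n
mod-cong {m} {o} n eq = toℕ-injective (trans (toℕ-mod m n) (trans eq (sym (toℕ-mod o n))))

Periodic : {A : Set} → (ℕ → A) → ℕ → Set
Periodic w d = ∀ i → w (i + d) ≡ w i

periodic-* : ∀ {A : Set} {w : ℕ → A} {d} → Periodic w d → ∀ m → Periodic w (m * d)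
periodic-* {w = w} per zero    i = cong w (+-identityʳ i)
periodic-* {w = w} {d} per (suc m) i = begin
  w (i + (d + m * d))  ≡⟨ cong w (+-assoc i d (m * d)) ⟨
  w (i + d + m * d)    ≡⟨ periodic-* per m (i + d) ⟩
  w (i + d)            ≡⟨ per i ⟩
  w i                  ∎
  where open ≡-Reasoning

periodic-difference : ∀ {A : Set} {w : ℕ → A} {d e} →
  Periodic w d → Periodic w (d + e) → Periodic w e
periodic-difference {w = w} {d} {e} per-d per-d+e i = begin
  w (i + e)            ≡⟨ per-d (i + e) ⟨
  w (i + e + d)        ≡⟨ cong w (+-assoc i e d) ⟩
  w (i + (e + d))      ≡⟨ cong (λ x → w (i + x)) (+-comm e d) ⟩
  w (i + (d + e))      ≡⟨ per-d+e i ⟩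
  w i                  ∎
  where open ≡-Reasoning

splice : {A : Set} → ℕ → (ℕ → A) → (ℕ → A) → ℕ → A
splice zero    u v j       = v j
splice (suc a) u v zero    = u zero
splice (suc a) u v (suc j) = splice a (u ∘ suc) v j

splice-head : ∀ {A : Set} a {u v : ℕ → A} → u a ≡ v 0 → splice a u v 0 ≡ u 0
splice-head zero    joint = sym joint
splice-head (suc a) _     = refl

splice-+ : ∀ {A : Set} a {u v : ℕ → A} j → splice a u v (a + j) ≡ v j
splice-+ zero    j = refl
splice-+ (suc a) j = splice-+ a j

injective-or-collision : ∀ {A : Set} → DecidableEquality A → ∀ {k} (f : Fin k → A) →
  Injective _≡_ _≡_ f ⊎ ∃₂ λ i j → i Fin.< j × f i ≡ f j
injective-or-collision _≟_ {zero}  f = inj₁ λ { {()} }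
injective-or-collision _≟_ {suc k} f with Finₚ.any? (λ j → f Fin.zero ≟ f (Fin.suc j))
... | yes (j , eq) = inj₂ (Fin.zero , Fin.suc j , s≤s z≤n , eq)
... | no  ¬eq with injective-or-collision _≟_ (f ∘ Fin.suc)
...   | inj₂ (i , j , i<j , eq) = inj₂ (Fin.suc i , Fin.suc j , s≤s i<j , eq)
...   | inj₁ injective-tail = inj₁ injective
  where
  injective : Injective _≡_ _≡_ f
  injective {Fin.zero}  {Fin.zero}  _  = refl
  injective {Fin.zero}  {Fin.suc j} eq = ⊥-elim (¬eq (j , eq))
  injective {Fin.suc i} {Fin.zero}  eq = ⊥-elim (¬eq (i , sym eq))
  injective {Fin.suc i} {Fin.suc j} eq = cong Fin.suc (injective-tail eq)

module Rotation (n : ℕ) .{{_ : NonZero n}} (v : ℕ) (v<n : v < n) where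

  offset : ℕ
  offset = n ∸ suc v

  rot : ℕ → ℕ
  rot x = (offset + x) % n

  rot-+ : ∀ a x → rot ((a + x) % n) ≡ (a + rot x) % n
  rot-+ a x = begin
    (offset + (a + x) % n) % n  ≡⟨ [m+o%n]%n≡[m+o]%n offset (a + x) n ⟩
    (offset + (a + x)) % n      ≡⟨ cong (_% n) (x∙yz≈y∙xz offset a x) ⟩
    (a + (offset + x)) % n      ≡⟨ [m+o%n]%n≡[m+o]%n a (offset + x) n ⟨
    (a + rot x) % n             ∎
    where open ≡-Reasoning

  unrot-rot : ∀ {x} → x < n → (suc v + rot x) % n ≡ x
  unrot-rot {x} x<n = begin
    (suc v + rot x) % n            ≡⟨ [m+o%n]%n≡[m+o]%n (suc v) (offset + x) n ⟩
    (suc v + (offset + x)) % n     ≡⟨ cong (_% n) (+-assoc (suc v) offset x) ⟨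
    (suc v + offset + x) % n       ≡⟨ cong (λ m → (m + x) % n) (m+[n∸m]≡n v<n) ⟩
    (n + x) % n                    ≡⟨ cong (_% n) (+-comm n x) ⟩
    (x + n) % n                    ≡⟨ [m+n]%n≡m%n x n ⟩
    x % n                          ≡⟨ m<n⇒m%n≡m x<n ⟩
    x                              ∎
    where open ≡-Reasoning

  -- The rotation sends v to n - 1, so away from v a step x ↦ x + 1 (mod n) never wraps around.
  rot-suc : ∀ {x} → x < n → x ≢ v → rot (suc x % n) ≡ suc (rot x)
  rot-suc {x} x<n x≢v with m≤n⇒m<n∨m≡n (m%n<n (offset + x) n)
  ... | inj₁ suc-rot<n = trans (rot-+ 1 x) (m<n⇒m%n≡m suc-rot<n)
  ... | inj₂ suc-rot≡n = ⊥-elim (x≢v (begin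
    x                    ≡⟨ unrot-rot x<n ⟨
    (suc v + rot x) % n  ≡⟨ cong (_% n) (+-suc v (rot x)) ⟨
    (v + suc (rot x)) % n ≡⟨ cong (λ m → (v + m) % n) suc-rot≡n ⟩
    (v + n) % n          ≡⟨ [m+n]%n≡m%n v n ⟩
    v % n                ≡⟨ m<n⇒m%n≡m v<n ⟩
    v                    ∎))
    where open ≡-Reasoning

jump<n : ∀ {n q p t a} → 2 ≤ q → n + 2 ≡ q * p → t < p → suc a ≡ q * t → a < n
jump<n {n} {q} {p} {t} {a} 2≤q n+2≡qp t<p suc-a≡qt = +-cancelʳ-≤ 2 (suc a) n (begin
  suc a + 2    ≤⟨ +-monoʳ-≤ (suc a) 2≤q ⟩
  suc a + q    ≡⟨ cong (_+ q) suc-a≡qt ⟩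
  q * t + q    ≡⟨ +-comm (q * t) q ⟩
  q + q * t    ≡⟨ *-suc q t ⟨
  q * suc t    ≤⟨ *-monoʳ-≤ q t<p ⟩
  q * p        ≡⟨ n+2≡qp ⟨
  n + 2        ∎)
  where open ≤-Reasoning

-- The jump x ↦ x + qt - 1 either stays below n, moving the residue mod q by -1, or wraps around
-- once, moving it by qt - 1 - n ≡ +1 since n ≡ -2 (mod q).
jump-residue : ∀ {n q p t a x y} .{{_ : NonZero n}} .{{_ : NonZero q}} → 2 ≤ q → n + 2 ≡ q * p →
  t < p → suc a ≡ q * t → x < n → y ≡ (a + x) % n → y % q ≡ suc x % q ⊎ suc y % q ≡ x % q
jump-residue {n} {q} {p} {t} {a} {x} 2≤q n+2≡qp t<p suc-a≡qt x<n refl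
  with m<n+n⇒m%n≡m⊎m%n+n≡m (+-mono-< (jump<n 2≤q n+2≡qp t<p suc-a≡qt) x<n)
... | inj₁ no-wrap = inj₂ (begin
  suc ((a + x) % n) % q  ≡⟨ cong (λ m → suc m % q) no-wrap ⟩
  (suc a + x) % q        ≡⟨ cong (λ m → (m + x) % q) suc-a≡qt ⟩
  (q * t + x) % q        ≡⟨ cong (_% q) (trans (+-comm (q * t) x) (cong (x +_) (*-comm q t))) ⟩
  (x + t * q) % q        ≡⟨ [m+kn]%n≡m%n x t q ⟩
  x % q                  ∎)
  where open ≡-Reasoning
... | inj₂ wrap with s , t+s≡p ← m≤n⇒∃[o]m+o≡n (<⇒≤ t<p) = inj₁ (begin
  y % q              ≡⟨ [m+kn]%n≡m%n y s q ⟨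
  (y + s * q) % q    ≡⟨ cong (λ m → (y + m) % q) (*-comm s q) ⟩
  (y + q * s) % q    ≡⟨ cong (_% q) (+-cancelʳ-≡ (q * t) (y + q * s) (suc x) winding) ⟩
  suc x % q          ∎)
  where
  open ≡-Reasoning
  y = (a + x) % n
  winding : y + q * s + q * t ≡ suc x + q * t
  winding = begin
    y + q * s + q * t      ≡⟨ +-assoc y (q * s) (q * t) ⟩
    y + (q * s + q * t)    ≡⟨ cong (y +_) (trans (sym (*-distribˡ-+ q s t)) (cong (q *_) (+-comm s t))) ⟩
    y + q * (t + s)        ≡⟨ cong (λ m → y + q * m) t+s≡p ⟩
    y + q * p              ≡⟨ cong (y +_) n+2≡qp ⟨
    y + (n + 2)            ≡⟨ +-assoc y n 2 ⟨
    y + n + 2              ≡⟨ cong (_+ 2) wrap ⟩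
    a + x + 2              ≡⟨ +-assoc a x 2 ⟩
    a + (x + 2)            ≡⟨ cong (a +_) (+-comm x 2) ⟩
    a + suc (suc x)        ≡⟨ +-suc a (suc x) ⟩
    suc a + suc x          ≡⟨ cong (_+ suc x) suc-a≡qt ⟩
    q * t + suc x          ≡⟨ +-comm (q * t) (suc x) ⟩
    suc x + q * t          ∎

longJump-complete : ∀ {n q i j} t p → 1 ≤ t → t < p → j ≡ modℕ n (i + q * t ∸ 1) →
  longJump n q i j p ≡ true
longJump-complete (suc t) (suc zero) _ (s≤s ()) _
longJump-complete {n} {q} {i} {j} t (suc (suc p)) 1≤t t<p eq =
  [ (λ t<p′ → ∨-trueʳ (j ≡ᵇ modℕ n (i + q * suc p ∸ 1))
                (longJump-complete t (suc p) 1≤t t<p′ eq))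
  , (λ { refl → ∨-trueˡ _ (≡⇒≡ᵇ-true eq) })
  ] (m≤n⇒m<n∨m≡n (s≤s⁻¹ t<p))

longJump-sound : ∀ {n q i j} p → longJump n q i j p ≡ true →
  ∃ λ t → 1 ≤ t × t < p × j ≡ modℕ n (i + q * t ∸ 1)
longJump-sound {n} {q} {i} {j} (suc (suc p)) jump =
  [ (λ eq → suc p , s≤s z≤n , ≤-refl , ≡ᵇ-true⇒≡ eq)
  , (λ jump′ → let t , 1≤t , t<p , eq = longJump-sound (suc p) jump′
               in  t , 1≤t , m<n⇒m<1+n t<p , eq)
  ] (∨-true⁻ (j ≡ᵇ modℕ n (i + q * suc p ∸ 1)) jump)

modℕ≡% : ∀ n .{{_ : NonZero n}} x → modℕ n x ≡ x % n
modℕ≡% (suc n) x = refl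

module _ (q p : ℕ) .{{_ : NonZero (gsize q p)}} {u v : Fin (gsize q p)} where

  private
    n = gsize q p

  Gqp-suc : toℕ v ≡ suc (toℕ u) % n → Gqp q p u v ≡ true
  Gqp-suc eq = ∨-trueˡ _ (≡⇒≡ᵇ-true (trans eq (sym (modℕ≡% n _))))

  Gqp-long : ∀ t → 1 ≤ t → t < p → toℕ v ≡ (toℕ u + q * t ∸ 1) % n → Gqp q p u v ≡ true
  Gqp-long t 1≤t t<p eq =
    ∨-trueʳ (toℕ v ≡ᵇ modℕ n (suc (toℕ u))) (∨-trueʳ (toℕ u ≡ᵇ modℕ n (suc (toℕ v)))
      (longJump-complete {n} {q} t p 1≤t t<p (trans eq (sym (modℕ≡% n _)))))

  Gqp-edge : Gqp q p u v ≡ true →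
    toℕ v ≡ suc (toℕ u) % n ⊎ toℕ u ≡ suc (toℕ v) % n ⊎
    ∃ λ t → 1 ≤ t × t < p × toℕ v ≡ (toℕ u + q * t ∸ 1) % n
  Gqp-edge edge with ∨-true⁻ (toℕ v ≡ᵇ modℕ n (suc (toℕ u))) edge
  ... | inj₁ eq = inj₁ (trans (≡ᵇ-true⇒≡ eq) (modℕ≡% n _))
  ... | inj₂ edge′ with ∨-true⁻ (toℕ u ≡ᵇ modℕ n (suc (toℕ v))) edge′
  ...   | inj₁ eq = inj₂ (inj₁ (trans (≡ᵇ-true⇒≡ eq) (modℕ≡% n _)))
  ...   | inj₂ jump with t , 1≤t , t<p , eq ← longJump-sound p jump =
    inj₂ (inj₂ (t , 1≤t , t<p , trans eq (modℕ≡% n _)))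

gsize+2 : ∀ r p → gsize (2 + r) (suc p) + 2 ≡ (2 + r) * suc p
gsize+2 r p = m∸n+n≡m (*-mono-≤ {2} {2 + r} {1} {suc p} (s≤s (s≤s z≤n)) (s≤s z≤n))

module _ (H : Graph) where

  Vertex : Set
  Vertex = Fin (size H)

  infix 4 _~_
  _~_ : Vertex → Vertex → Set
  x ~ y = adj H x y ≡ true

  ~-sym : ∀ {x y} → x ~ y → y ~ x
  ~-sym {x} {y} x~y = trans (Graph.sym H y x) x~y

  ~⇒≢ : ∀ {x y} → x ~ y → x ≢ y
  ~⇒≢ {x} x~x refl with () ← trans (sym x~x) (irrefl H x)

  Walk : ℕ → (ℕ → Vertex) → Set
  Walk k w = ∀ i → i < k → w i ~ w (suc i)

  ClosedWalk : ℕ → (ℕ → Vertex) → Set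
  ClosedWalk k w = Walk k w × w k ≡ w 0

  InfiniteWalk : (ℕ → Vertex) → Set
  InfiniteWalk w = ∀ i → w i ~ w (suc i)

  walk-take : ∀ {k l w} → l ≤ k → Walk k w → Walk l w
  walk-take l≤k walk i i<l = walk i (<-≤-trans i<l l≤k)

  walk-drop : ∀ a {l w} → Walk (a + l) w → Walk l (λ j → w (a + j))
  walk-drop a {w = w} walk j j<l =
    subst (λ x → w (a + j) ~ w x) (sym (+-suc a j)) (walk (a + j) (+-monoʳ-< a j<l))

  walk-splice : ∀ a {e u v} → Walk a u → Walk e v → u a ≡ v 0 → Walk (a + e) (splice a u v)
  walk-splice zero    _      walk-v _     = walk-v
  walk-splice (suc a) {u = u} walk-u _ joint zero _ =
    subst (u 0 ~_) (sym (splice-head a joint)) (walk-u 0 (s≤s z≤n))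
  walk-splice (suc a) walk-u walk-v joint (suc i) (s≤s i<a+e) =
    walk-splice a (λ j j<a → walk-u (suc j) (s≤s j<a)) walk-v joint i i<a+e

  closedWalk-split : ∀ a d e {w} → ClosedWalk (a + d + e) w → w (a + d) ≡ w a →
    ClosedWalk d (λ j → w (a + j)) × ClosedWalk (a + e) (splice a w (λ j → w (a + d + j)))
  closedWalk-split a d e {w} (walk , closed) loop =
      (walk-drop a (walk-take (m≤m+n (a + d) e) walk) , trans loop (cong w (sym (+-identityʳ a))))
    , ( walk-splice a (walk-take (≤-trans (m≤m+n a d) (m≤m+n (a + d) e)) walk)
                      (walk-drop (a + d) walk) joint
      , trans (splice-+ a e) (trans closed (sym (splice-head a joint))))
    where
    joint : w a ≡ w (a + d + 0)
    joint = trans (sym loop) (cong w (sym (+-identityʳ (a + d))))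

  injective-or-repeat : ∀ k (w : ℕ → Vertex) →
    Injective _≡_ _≡_ (w ∘ toℕ {k}) ⊎
    ∃₂ λ a d → ∃ λ e → k ≡ a + suc d + suc e × w a ≡ w (a + suc d)
  injective-or-repeat k w with injective-or-collision Finₚ._≟_ (w ∘ toℕ {k})
  ... | inj₁ injective = inj₁ injective
  ... | inj₂ (i , j , i<j , wi≡wj)
    with d , j≡i+d ← <⇒≡+suc i<j | e , k≡j+e ← <⇒≡+suc (toℕ<n j) =
    inj₂ (toℕ i , d , e , trans k≡j+e (cong (_+ suc e) j≡i+d) , trans wi≡wj (cong w j≡i+d))

  closedWalk⇒cycle : ∀ k {w} → Odd k → ClosedWalk k w →
    Injective _≡_ _≡_ (w ∘ toℕ {k}) → Cycle H k
  closedWalk⇒cycle zero    (_ , ()) _ _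
  closedWalk⇒cycle (suc zero) _ (walk , closed) _ = ⊥-elim (~⇒≢ (walk 0 (s≤s z≤n)) (sym closed))
  closedWalk⇒cycle (suc (suc zero)) odd _ _ with () ← Odd⇒parity≡1ℙ odd
  closedWalk⇒cycle k@(suc (suc (suc _))) {w} _ (walk , closed) injective =
    s≤s (s≤s (s≤s z≤n)) , w ∘ toℕ , injective ,
    λ i → subst (w (toℕ i) ~_) (cyclic (toℕ<n i)) (walk (toℕ i) (toℕ<n i))
    where
    read-mod : ∀ {m} → m ≤ k → w m ≡ w (m % k)
    read-mod m≤k with m≤n⇒m<n∨m≡n m≤k
    ... | inj₁ m<k  = cong w (sym (m<n⇒m%n≡m m<k))
    ... | inj₂ refl = trans closed (cong w (sym (n%n≡0 k)))
    cyclic : ∀ {j} → j < k → w (suc j) ≡ w (toℕ (suc j mod k))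
    cyclic {j} j<k = trans (read-mod j<k) (cong w (sym (toℕ-mod (suc j) k)))

  odd-closedWalk⇒cycle⊎shorter : ∀ {k w} → Odd k → ClosedWalk k w →
    Cycle H k ⊎ ∃₂ λ l w′ → l < k × Odd l × ClosedWalk l w′
  odd-closedWalk⇒cycle⊎shorter {k} {w} odd cw with injective-or-repeat k w
  ... | inj₁ injective = inj₁ (closedWalk⇒cycle k odd cw injective)
  ... | inj₂ (a , d , e , refl , repeat)
    with inner , outer ← closedWalk-split a (suc d) (suc e) cw (sym repeat) =
    [ (λ odd-inner → inj₂ (_ , _ , inner<k , odd-inner , inner))
    , (λ odd-outer → inj₂ (_ , _ , outer<k , odd-outer , outer))
    ] (Odd-+ (suc d) (a + suc e) (subst Odd (trans (+-assoc a _ _) (x∙yz≈y∙xz a (suc d) (suc e))) odd))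
    where
    inner<k : suc d < a + suc d + suc e
    inner<k = ≤-<-trans (m≤n+m (suc d) a) (m<m+n (a + suc d) (s≤s z≤n))
    outer<k : a + suc e < a + suc d + suc e
    outer<k = +-monoˡ-< (suc e) (m<m+n a (s≤s z≤n))

  girth≤closedWalk : ∀ {q} → (∀ k → Odd k → Cycle H k → q ≤ k) →
    ∀ {k w} → Odd k → ClosedWalk k w → q ≤ k
  girth≤closedWalk {q} girth {k} = go (<-wellFounded k)
    where
    go : ∀ {k w} → Acc _<_ k → Odd k → ClosedWalk k w → q ≤ k
    go {k} (acc shorter) odd cw with odd-closedWalk⇒cycle⊎shorter odd cw
    ... | inj₁ cycle = girth k odd cycle
    ... | inj₂ (_ , _ , l<k , odd-l , cw-l) = ≤-trans (go (shorter l<k) odd-l cw-l) (<⇒≤ l<k)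

  square-degenerate : ¬ ContainsC4 H →
    ∀ {a b c d} → a ~ b → b ~ c → c ~ d → d ~ a → a ≡ c ⊎ b ≡ d
  square-degenerate noC4 {a} {b} {c} {d} ab bc cd da with a Finₚ.≟ c | b Finₚ.≟ d
  ... | yes a≡c | _       = inj₁ a≡c
  ... | no _    | yes b≡d = inj₂ b≡d
  ... | no a≢c  | no b≢d  =
    ⊥-elim (noC4 (s≤s (s≤s (s≤s z≤n)) , lookup corners , lookup-injective distinct _ _ , edges))
    where
    corners = a ∷ b ∷ c ∷ d ∷ []
    distinct : Unique corners
    distinct = (~⇒≢ ab ∷ a≢c ∷ ~⇒≢ (~-sym da) ∷ [])
             ∷ (~⇒≢ bc ∷ b≢d ∷ [])
             ∷ (~⇒≢ cd ∷ [])
             ∷ []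
             ∷ []
    edges : ∀ i → lookup corners i ~ lookup corners (nextMod i)
    edges Fin.zero                                = ab
    edges (Fin.suc Fin.zero)                      = bc
    edges (Fin.suc (Fin.suc Fin.zero))            = cd
    edges (Fin.suc (Fin.suc (Fin.suc Fin.zero)))  = da

  module _ {r : ℕ} (odd-q : Odd (2 + r)) (girth : ∀ k → Odd k → Cycle H k → 2 + r ≤ k)
           (noC4 : ¬ ContainsC4 H) where

    no-closed-segment : ∀ {w} → InfiniteWalk w → ∀ a → w (a + r) ≢ w a
    no-closed-segment {w} walk a loop = 1+n≰n (m+n≤o⇒n≤o 1 (girth≤closedWalk girth odd-r segment))
      where
      odd-r : Odd r
      odd-r = parity≡1ℙ⇒Odd r (Odd⇒parity≡1ℙ odd-q)
      segment : ClosedWalk r (λ j → w (a + j))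
      segment = walk-drop a (λ i _ → walk i) , trans loop (cong w (sym (+-identityʳ a)))

    chords⇒periodic : ∀ {w} → InfiniteWalk w → (∀ i → w i ~ w (i + suc r)) → Periodic w (2 + r)
    chords⇒periodic {w} walk chord i =
      [ sym , ⊥-elim ∘ short-diagonal ]
        (square-degenerate noC4 (walk i) up (~-sym down) (~-sym (chord i)))
      where
      up : w (suc i) ~ w (i + (2 + r))
      up = subst (λ x → w (suc i) ~ w x) (sym (+-suc i (suc r))) (chord (suc i))
      down : w (i + suc r) ~ w (i + (2 + r))
      down = subst (λ x → w (i + suc r) ~ w x) (sym (+-suc i (suc r))) (walk (i + suc r))
      short-diagonal : w (suc i) ≢ w (i + suc r)
      short-diagonal eq = no-closed-segment walk (suc i) (trans (cong w (sym (+-suc i r))) (sym eq))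

    no-periodic-walk-with-chords : ∀ {w n} p → InfiniteWalk w → Periodic w n →
      n + 2 ≡ (2 + r) * suc p → (0 < p → ∀ i → w i ~ w (i + suc r)) → ⊥
    no-periodic-walk-with-chords {w} {n} zero walk per-n n+2≡q _ =
      no-closed-segment walk 0 (subst (λ m → w m ≡ w 0) n≡r (per-n 0))
      where
      n≡r : n ≡ r
      n≡r = +-cancelʳ-≡ 2 n r (trans n+2≡q (trans (*-identityʳ (2 + r)) (+-comm 2 r)))
    no-periodic-walk-with-chords {w} {n} p@(suc _) walk per-n n+2≡qp chords =
      ~⇒≢ (walk 0) (sym (per-1 0))
      where
      per-q : Periodic w (2 + r)
      per-q = chords⇒periodic walk (chords (s≤s z≤n))
      per-2 : Periodic w 2
      per-2 = periodic-difference per-n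
        (subst (Periodic w) (trans (*-comm (suc p) (2 + r)) (sym n+2≡qp)) (periodic-* per-q (suc p)))
      per-1 : Periodic w 1
      per-1 = let t , q≡1+2t = odd-q in periodic-difference
        (subst (Periodic w) (*-comm t 2) (periodic-* per-2 t))
        (subst (Periodic w) (trans q≡1+2t (+-comm 1 (2 * t))) per-q)

    Gqp-not-colorable : ∀ p .{{_ : NonZero (gsize (2 + r) (suc p))}} →
      ¬ Coloring H (Gqp (2 + r) (suc p))
    Gqp-not-colorable p (c , hom) =
      no-periodic-walk-with-chords p walk periodic (gsize+2 r p) chords
      where
      q = 2 + r
      n = gsize q (suc p)
      w : ℕ → Vertex
      w i = c (i mod n)
      walk : InfiniteWalk w
      walk i = hom _ _ (Gqp-suc q (suc p) (begin
        toℕ (suc i mod n)          ≡⟨ toℕ-mod (suc i) n ⟩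
        suc i % n                  ≡⟨ [m+o%n]%n≡[m+o]%n 1 i n ⟨
        suc (i % n) % n            ≡⟨ cong (λ m → suc m % n) (toℕ-mod i n) ⟨
        suc (toℕ (i mod n)) % n    ∎))
        where open ≡-Reasoning
      periodic : Periodic w n
      periodic i = cong c (mod-cong n ([m+n]%n≡m%n i n))
      chords : 0 < p → ∀ i → w i ~ w (i + suc r)
      chords 0<p i = hom _ _ (Gqp-long q (suc p) 1 (s≤s z≤n) (s≤s 0<p) (begin
        toℕ ((i + suc r) mod n)               ≡⟨ toℕ-mod (i + suc r) n ⟩
        (i + suc r) % n                       ≡⟨ [m%n+o]%n≡[m+o]%n i (suc r) n ⟨
        (i % n + suc r) % n                   ≡⟨ cong (λ m → (m + suc r) % n) (toℕ-mod i n) ⟨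
        (x + suc r) % n                       ≡⟨ cong (λ m → (x + (m ∸ 1)) % n) (*-identityʳ q) ⟨
        (x + (q * 1 ∸ 1)) % n                 ≡⟨ cong (_% n) (+-∸-assoc x (s≤s z≤n)) ⟨
        (x + q * 1 ∸ 1) % n                   ∎))
        where
        open ≡-Reasoning
        x = toℕ (i mod n)

  cycle-adj-mod : ∀ {k} (f : Fin (suc k) → Vertex) → (∀ i → f i ~ f (nextMod i)) →
    ∀ {x y} → y % suc k ≡ suc x % suc k → f (x mod suc k) ~ f (y mod suc k)
  cycle-adj-mod {k} f edges {x} {y} y≡1+x =
    subst (λ i → f (x mod suc k) ~ f i) next≡y (edges (x mod suc k))
    where
    next≡y : suc (toℕ (x mod suc k)) mod suc k ≡ y mod suc k
    next≡y = mod-cong {suc (toℕ (x mod suc k))} {y} (suc k) (begin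
      suc (toℕ (x mod suc k)) % suc k  ≡⟨ cong (λ m → suc m % suc k) (toℕ-mod x (suc k)) ⟩
      suc (x % suc k) % suc k          ≡⟨ [m+o%n]%n≡[m+o]%n 1 x (suc k) ⟩
      suc x % suc k                    ≡⟨ y≡1+x ⟨
      y % suc k                        ∎)
      where open ≡-Reasoning

  ColoringAvoiding : ∀ {n} → Adj n → Fin n → Set
  ColoringAvoiding {n} E v =
    Σ (Fin n → Vertex) λ c → ∀ u u′ → u ≢ v → u′ ≢ v → E u u′ ≡ true → c u ~ c u′

  ColoringAvoiding⇒ColoringOn : ∀ {n} {E : Adj n} {S : Fin n → Bool} {v} → S v ≡ false →
    ColoringAvoiding E v → ColoringOn H E S
  ColoringAvoiding⇒ColoringOn {S = S} Sv≡false (c , respects) =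
    (λ u _ → c u) , λ u u′ Su Su′ → respects u u′ (avoids Su) (avoids Su′)
    where
    avoids : ∀ {u} → S u ≡ true → u ≢ _
    avoids Su refl with () ← trans (sym Su) Sv≡false

  Gqp-coloring-avoiding : ∀ {r} p .{{_ : NonZero (gsize (2 + r) (suc p))}} → Cycle H (2 + r) →
    (v : Fin (gsize (2 + r) (suc p))) → ColoringAvoiding (Gqp (2 + r) (suc p)) v
  Gqp-coloring-avoiding {r} p (_ , f , _ , edges) v = color , respects
    where
    q = 2 + r
    n = gsize q (suc p)
    open Rotation n (toℕ v) (toℕ<n v)
    color : Fin n → Vertex
    color u = f (rot (toℕ u) mod q)
    color-adj : ∀ u u′ → rot (toℕ u′) % q ≡ suc (rot (toℕ u)) % q → color u ~ color u′
    color-adj u u′ = cycle-adj-mod f edges {rot (toℕ u)} {rot (toℕ u′)}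
    step-adj : ∀ u u′ → u ≢ v → toℕ u′ ≡ suc (toℕ u) % n → color u ~ color u′
    step-adj u u′ u≢v step =
      color-adj u u′ (cong (_% q) (trans (cong rot step) (rot-suc (toℕ<n u) (u≢v ∘ toℕ-injective))))
    respects : ∀ u u′ → u ≢ v → u′ ≢ v → Gqp q (suc p) u u′ ≡ true → color u ~ color u′
    respects u u′ u≢v u′≢v edge with Gqp-edge q (suc p) edge
    ... | inj₁ forward          = step-adj u u′ u≢v forward
    ... | inj₂ (inj₁ backward)  = ~-sym (step-adj u′ u u′≢v backward)
    ... | inj₂ (inj₂ (t , 1≤t , t<p , jump)) =
      [ color-adj u u′ , ~-sym ∘ color-adj u′ u ∘ sym ]
        (jump-residue (s≤s (s≤s z≤n)) (gsize+2 r p) t<p 1+a≡qt (m%n<n _ n) rot-jump)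
      where
      a = q * t ∸ 1
      1≤qt : 1 ≤ q * t
      1≤qt = *-mono-≤ {1} {q} {1} {t} (s≤s z≤n) 1≤t
      1+a≡qt : suc a ≡ q * t
      1+a≡qt = trans (+-comm 1 a) (m∸n+n≡m 1≤qt)
      rot-jump : rot (toℕ u′) ≡ (a + rot (toℕ u)) % n
      rot-jump = begin
        rot (toℕ u′)                  ≡⟨ cong rot jump ⟩
        rot ((toℕ u + q * t ∸ 1) % n) ≡⟨ cong (λ m → rot (m % n)) (+-∸-assoc (toℕ u) 1≤qt) ⟩
        rot ((toℕ u + a) % n)         ≡⟨ cong (λ m → rot (m % n)) (+-comm (toℕ u) a) ⟩
        rot ((a + toℕ u) % n)         ≡⟨ rot-+ a (toℕ u) ⟩
        (a + rot (toℕ u)) % n         ∎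
        where open ≡-Reasoning

lemma4 : (q : ℕ) → 3 ≤ q → Odd q → (H : Graph) → OddGirth H q → ¬ ContainsC4 H →
    (p : ℕ) → 1 ≤ p → MinimalObstruction H (Gqp q p)
lemma4 (suc (suc r)) 3≤q odd-q H (cycle , girth) noC4 (suc p) 1≤p =
    Gqp-not-colorable H odd-q girth noC4 p
  , λ S (v , Sv≡false) → ColoringAvoiding⇒ColoringOn H Sv≡false (Gqp-coloring-avoiding H p cycle v)
  where
  instance
    n≢0 : NonZero (gsize (2 + r) (suc p))
    n≢0 = >-nonZero (∸-monoˡ-≤ 2 (*-mono-≤ 3≤q 1≤p))
lemma4 (suc zero) (s≤s ()) _ _ _ _ _ _
lemma4 (suc (suc r)) _ _ _ _ _ zero ()
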